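{- Fix finite sets $\Sigma_C$ of concept names and $\Sigma_R$ of role names. For all $n,k\geq 0$ there is a finite set of examples $E^+_{n,k}$ (finite pointed interpretations) such that for every concept $C\in\mathcal{L}(\forall,\exists,\geq,\sqcap,\top)[\Sigma_C,\Sigma_R]$ the following are equivalent: (1) $C$ is equivalent to a concept of role depth at most $n$ and maximum number restriction $k$; (2) $d\in C^{\mathcal I}$ for every $(\mathcal I,d)\in E^+_{n,k}$.
   Context: $\mathcal{L}(\forall,\exists,\geq,\sqcap,\top)[\Sigma_C,\Sigma_R]$ is the set of concepts $C ::= A\mid\top\mid C\sqcap C\mid\exists R.C\mid\forall R.C\mid(\geq m\,R.C)$ with $A\in\Sigma_C$, $R\in\Sigma_R$, $m\ge1$, standard semantics ($\geq m\,R.C$: at least $m$ pairwise distinct $R$-successors in $C$). The role depth of $C$ is the maximal nesting depth of $\exists$, $\forall$ and $\geq$ in $C$; the maximum number restriction of $C$ is the largest natural number occurring in $C$. Equivalence means equal extensions in all interpretations. -}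

module Defs where

open import Level using (0ℓ)
open import Data.Nat using (ℕ; zero; suc; _≤_; _⊔_)
open import Data.Fin using (Fin)
open import Data.Bool using (Bool; T)
open import Data.Unit using (⊤)
open import Data.Product using (Σ; _×_; ∃)
open import Data.List using (List)
open import Relation.Binary.PropositionalEquality using (_≡_)

-- Signature: Σ_C = Fin nc (concept names), Σ_R = Fin nr (role names).

data Concept (nc nr : ℕ) : Set where
  name   : Fin nc → Concept nc nr
  top    : Concept nc nr
  _⊓_    : Concept nc nr → Concept nc nr → Concept nc nr
  exists : Fin nr → Concept nc nr → Concept nc nr
  value-restriction : Fin nr → Concept nc nr → Concept nc nr
  atLeast : (m : ℕ) → 1 ≤ m → Fin nr → Concept nc nr → Concept nc nr

depth : ∀ {nc nr} → Concept nc nr → ℕ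
depth (name _)          = 0
depth top               = 0
depth (C ⊓ D)           = depth C ⊔ depth D
depth (exists _ C)      = suc (depth C)
depth (value-restriction _ C)      = suc (depth C)
depth (atLeast _ _ _ C) = suc (depth C)

maxNum : ∀ {nc nr} → Concept nc nr → ℕ
maxNum (name _)          = 0
maxNum top               = 0
maxNum (C ⊓ D)           = maxNum C ⊔ maxNum D
maxNum (exists _ C)      = maxNum C
maxNum (value-restriction _ C)      = maxNum C
maxNum (atLeast m _ _ C) = m ⊔ maxNum C

record Interpretation (nc nr : ℕ) : Set₁ where
  field
    Δ    : Set
    conc : Fin nc → Δ → Set
    role : Fin nr → Δ → Δ → Set
open Interpretation public

⟦_⟧ : ∀ {nc nr} → Concept nc nr → (I : Interpretation nc nr) → Δ I → Set
⟦ name A ⟧          I d = conc I A d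
⟦ top ⟧             I d = ⊤
⟦ C ⊓ D ⟧           I d = ⟦ C ⟧ I d × ⟦ D ⟧ I d
⟦ exists R C ⟧      I d = Σ (Δ I) λ e → role I R d e × ⟦ C ⟧ I e
⟦ value-restriction R C ⟧      I d = (e : Δ I) → role I R d e → ⟦ C ⟧ I e
⟦ atLeast m _ R C ⟧ I d =
  Σ (Fin m → Δ I) λ f →
    ((i j : Fin m) → f i ≡ f j → i ≡ j) ×
    ((i : Fin m) → role I R d (f i) × ⟦ C ⟧ I (f i))

_≡ᶜ_ : ∀ {nc nr} → Concept nc nr → Concept nc nr → Set₁
_≡ᶜ_ {nc} {nr} C D = (I : Interpretation nc nr) (d : Δ I) →
  (⟦ C ⟧ I d → ⟦ D ⟧ I d) × (⟦ D ⟧ I d → ⟦ C ⟧ I d)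

record FinInterpretation (nc nr : ℕ) : Set where
  field
    size  : ℕ
    concᶠ : Fin nc → Fin size → Bool
    roleᶠ : Fin nr → Fin size → Fin size → Bool
open FinInterpretation public

toInterp : ∀ {nc nr} → FinInterpretation nc nr → Interpretation nc nr
toInterp J = record
  { Δ    = Fin (size J)
  ; conc = λ A d → T (concᶠ J A d)
  ; role = λ R d e → T (roleᶠ J R d e)
  }

record Example (nc nr : ℕ) : Set where
  constructor ⟨_,_⟩
  field
    interp : FinInterpretation nc nr
    point  : Fin (size interp)
open Example public

_satisfies_ : ∀ {nc nr} → Example nc nr → Concept nc nr → Set
e satisfies C = ⟦ C ⟧ (toInterp (interp e)) (point e)

-- For n = 0 a point without
-- successors refutes every ∃ and ≥, and a two-point model refutes every
-- ∀R.C unless C is built from ⊤ by ⊓ and ∀ (and then ∀R.C ≡ ⊤).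
-- For n + 1 we take a (k ⊔ 1)-clique, which satisfies every concept whose
-- numbers are at most k but refutes (≥ m R.C) for m > k ⊔ 1, together with,
-- for each example (J, p) of level n, a fresh root whose successors along
-- every role are k + 1 copies of p.  Each copy is a successor-closed
-- substructure, hence satisfies exactly the concepts p satisfies; so the root
-- satisfies all bounded concepts of depth n + 1 when p satisfies those of
-- depth n, and refutes ∃R.C, ∀R.C and (≥ m R.C) as soon as p refutes C.
-- A structural recursion then shows that every concept is either
-- equivalent to a bounded one or refuted by some example; the argument is
-- constructive.
module Submission where

open import Defs
open import Level using (0ℓ)
open import Axiom.ExcludedMiddle using (ExcludedMiddle)
open import Data.Nat using (ℕ; zero; suc; pred; _*_; _≤_; _<_; z≤n; s≤s; _≤?_)
open import Data.Nat.Properties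
  using (m⊔n≤o⇒m≤o; m⊔n≤o⇒n≤o; ⊔-lub; ≤-refl; ≤-trans; m≤n⇒m≤1+n; ≰⇒>;
         pred-mono-≤)
open import Data.Fin using (Fin; zero; suc; inject≤)
open import Data.Fin.Properties
  using (_≟_; inject≤-injective; pigeonhole; <⇒≢; +↔⊎; *↔×; 1↔⊤)
open import Data.Bool using (Bool; true; false)
open import Data.Unit using (⊤; tt)
open import Data.Empty using (⊥; ⊥-elim)
open import Data.Product using (Σ; ∃; _×_; _,_; proj₁; proj₂)
import Data.Product as Product
open import Data.Sum using (_⊎_; inj₁; inj₂; [_,_]′)
import Data.Sum as Sum
open import Data.Sum.Function.Propositional using (_⊎-↔_)
open import Data.List using (List; []; _∷_; map)
open import Data.List.Relation.Unary.All using (All; lookupAny)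
import Data.List.Relation.Unary.All as All
open import Data.List.Relation.Unary.Any using (Any; here; there)
import Data.List.Relation.Unary.Any as Any
import Data.List.Relation.Unary.All.Properties as All
import Data.List.Relation.Unary.Any.Properties as Any
open import Function using (id; _∘_)
open import Function.Bundles using (_⇔_; mk⇔; Equivalence; _↔_; mk↔ₛ′; Inverse)
open import Function.Properties.Inverse using (↔-trans)
open import Relation.Nullary using (¬_; Dec; yes; no)
open import Relation.Nullary.Decidable using (isYes; toWitness; fromWitness; T?; _×-dec_)
open import Relation.Binary.Definitions using (DecidableEquality)
open import Relation.Binary.PropositionalEquality using (_≡_; refl; sym; trans; cong; subst)

open Equivalence using (to; from)

private variable
  nc nr n k m : ℕ

≡ᶜ-trans : {C D E : Concept nc nr} → C ≡ᶜ D → D ≡ᶜ E → C ≡ᶜ E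
≡ᶜ-trans C≡D D≡E I x = proj₁ (D≡E I x) ∘ proj₁ (C≡D I x)
                     , proj₂ (C≡D I x) ∘ proj₂ (D≡E I x)

⊓-cong : {C C′ D D′ : Concept nc nr} →
         C ≡ᶜ C′ → D ≡ᶜ D′ → (C ⊓ D) ≡ᶜ (C′ ⊓ D′)
⊓-cong C≡C′ D≡D′ I x = Product.map (proj₁ (C≡C′ I x)) (proj₁ (D≡D′ I x))
                     , Product.map (proj₂ (C≡C′ I x)) (proj₂ (D≡D′ I x))

exists-cong : ∀ R {C D : Concept nc nr} → C ≡ᶜ D → exists R C ≡ᶜ exists R D
exists-cong R C≡D I x = Product.map₂ (Product.map₂ (proj₁ (C≡D I _)))
                      , Product.map₂ (Product.map₂ (proj₂ (C≡D I _)))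

value-restriction-cong : ∀ R {C D : Concept nc nr} → C ≡ᶜ D →
                         value-restriction R C ≡ᶜ value-restriction R D
value-restriction-cong R C≡D I x = (λ c y r → proj₁ (C≡D I y) (c y r))
                                 , (λ d y r → proj₂ (C≡D I y) (d y r))

atLeast-cong : ∀ m q R {C D : Concept nc nr} →
               C ≡ᶜ D → atLeast m q R C ≡ᶜ atLeast m q R D
atLeast-cong m q R C≡D I x =
  Product.map₂ (Product.map₂ λ succ i → Product.map₂ (proj₁ (C≡D I _)) (succ i))
  , Product.map₂ (Product.map₂ λ succ i → Product.map₂ (proj₂ (C≡D I _)) (succ i))

atLeast-1≡ᶜexists : ∀ q R (C : Concept nc nr) → atLeast 1 q R C ≡ᶜ exists R C
atLeast-1≡ᶜexists q R C I x =
  (λ (f , _ , succ) → f zero , succ zero)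
  , λ { (y , r , c) → (λ _ → y) , (λ { zero zero _ → refl }) , (λ _ → r , c) }

Expressible : ℕ → ℕ → Concept nc nr → Set₁
Expressible {nc} {nr} n k C =
  Σ (Concept nc nr) λ D → (C ≡ᶜ D) × (depth D ≤ n) × (maxNum D ≤ k)

SatisfiesBounded : ℕ → ℕ → (I : Interpretation nc nr) → Δ I → Set
SatisfiesBounded {nc} {nr} n k I x =
  (D : Concept nc nr) → depth D ≤ n → maxNum D ≤ k → ⟦ D ⟧ I x

expressible-⊓ : {C D : Concept nc nr} →
                Expressible n k C → Expressible n k D → Expressible n k (C ⊓ D)
expressible-⊓ {C = C} {D} (C′ , C≡C′ , dC , mC) (D′ , D≡D′ , dD , mD) =
  C′ ⊓ D′ , ⊓-cong {C = C} {C′} {D} {D′} C≡C′ D≡D′ , ⊔-lub dC dD , ⊔-lub mC mD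

expressible-∃ : ∀ R {C : Concept nc nr} →
                Expressible n k C → Expressible (suc n) k (exists R C)
expressible-∃ R {C} (D , C≡D , d , mx) = exists R D , exists-cong R {C} {D} C≡D , s≤s d , mx

expressible-∀ : ∀ R {C : Concept nc nr} →
                Expressible n k C → Expressible (suc n) k (value-restriction R C)
expressible-∀ R {C} (D , C≡D , d , mx) =
  value-restriction R D , value-restriction-cong R {C} {D} C≡D , s≤s d , mx

expressible-≥ : ∀ q R {C : Concept nc nr} → m ≤ k →
                Expressible n k C → Expressible (suc n) k (atLeast m q R C)
expressible-≥ {m = m} q R {C} m≤k (D , C≡D , d , mx) =
  atLeast m q R D , atLeast-cong m q R {C} {D} C≡D , s≤s d , ⊔-lub m≤k mx

-- (≥ 1 R.C) exceeds the bound k = 0, but it is equivalent to ∃R.C.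
expressible-≥1 : ∀ q R {C : Concept nc nr} →
                 Expressible n k C → Expressible (suc n) k (atLeast 1 q R C)
expressible-≥1 q R {C} C-expr with expressible-∃ R {C} C-expr
... | D , ∃C≡D , d , mx =
  D , ≡ᶜ-trans {C = atLeast 1 q R C} {exists R C} {D} (atLeast-1≡ᶜexists q R C) ∃C≡D , d , mx

data Trivial {nc nr} : Concept nc nr → Set where
  top               : Trivial top
  _⊓_               : ∀ {C D} → Trivial C → Trivial D → Trivial (C ⊓ D)
  value-restriction : ∀ {R C} → Trivial C → Trivial (value-restriction R C)

trivial⇒valid : {C : Concept nc nr} → Trivial C → ∀ I x → ⟦ C ⟧ I x
trivial⇒valid top                   I x = tt
trivial⇒valid (C ⊓ D)               I x = trivial⇒valid C I x , trivial⇒valid D I x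
trivial⇒valid (value-restriction C) I x = λ y _ → trivial⇒valid C I y

expressible-trivial : {C : Concept nc nr} → Trivial C → Expressible n k C
expressible-trivial C-triv =
  top , (λ I x → (λ _ → tt) , (λ _ → trivial⇒valid C-triv I x)) , z≤n , z≤n

-- Embeddings onto successor-closed substructures preserve all concepts

record Embedding {nc nr} (J I : Interpretation nc nr) (h : Δ J → Δ I) : Set where
  field
    injective        : ∀ {x y} → h x ≡ h y → x ≡ y
    conc-⇔           : ∀ A x → conc J A x ⇔ conc I A (h x)
    role-⇔           : ∀ R x y → role J R x y ⇔ role I R (h x) (h y)
    successor-closed : ∀ R x z → role I R (h x) z → ∃ λ y → h y ≡ z

module _ {J I : Interpretation nc nr} {h : Δ J → Δ I} (e : Embedding J I h) where
  open Embedding e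

  private
    successor-preimage : ∀ {P : Δ J → Set} {Q : Δ I → Set} {R x z} →
                         (∀ y → Q (h y) → P y) → role I R (h x) z → Q z →
                         Σ (Δ J) λ y → h y ≡ z × role J R x y × P y
    successor-preimage {R = R} {x} {z} Q⇒P r q with successor-closed R x z r
    ... | y , refl = y , refl , from (role-⇔ R x y) r , Q⇒P y q

  embedding-⟦⟧ : ∀ C x → ⟦ C ⟧ J x ⇔ ⟦ C ⟧ I (h x)
  embedding-⟦⟧ (name A) x = conc-⇔ A x
  embedding-⟦⟧ top x = mk⇔ id id
  embedding-⟦⟧ (C ⊓ D) x =
    mk⇔ (Product.map (to (embedding-⟦⟧ C x)) (to (embedding-⟦⟧ D x)))
        (Product.map (from (embedding-⟦⟧ C x)) (from (embedding-⟦⟧ D x)))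
  embedding-⟦⟧ (exists R C) x = mk⇔ forth back
    where
    forth : ⟦ exists R C ⟧ J x → ⟦ exists R C ⟧ I (h x)
    forth (y , r , c) = h y , to (role-⇔ R x y) r , to (embedding-⟦⟧ C y) c
    back : ⟦ exists R C ⟧ I (h x) → ⟦ exists R C ⟧ J x
    back (z , r , c) with successor-preimage {Q = ⟦ C ⟧ I} (from ∘ embedding-⟦⟧ C) r c
    ... | y , _ , r′ , c′ = y , r′ , c′
  embedding-⟦⟧ (value-restriction R C) x = mk⇔ forth back
    where
    forth : ⟦ value-restriction R C ⟧ J x → ⟦ value-restriction R C ⟧ I (h x)
    forth c z r with successor-closed R x z r
    ... | y , refl = to (embedding-⟦⟧ C y) (c y (from (role-⇔ R x y) r))
    back : ⟦ value-restriction R C ⟧ I (h x) → ⟦ value-restriction R C ⟧ J x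
    back c y r = from (embedding-⟦⟧ C y) (c (h y) (to (role-⇔ R x y) r))
  embedding-⟦⟧ (atLeast m q R C) x = mk⇔ forth back
    where
    forth : ⟦ atLeast m q R C ⟧ J x → ⟦ atLeast m q R C ⟧ I (h x)
    forth (f , f-inj , succ) =
      h ∘ f , (λ i j → f-inj i j ∘ injective)
      , λ i → Product.map (to (role-⇔ R x (f i))) (to (embedding-⟦⟧ C (f i))) (succ i)
    back : ⟦ atLeast m q R C ⟧ I (h x) → ⟦ atLeast m q R C ⟧ J x
    back (g , g-inj , succ) =
      proj₁ ∘ pre
      , (λ i j eq → g-inj i j (trans (sym (h-pre i)) (trans (cong h eq) (h-pre j))))
      , λ i → proj₂ (proj₂ (pre i))
      where
      pre : ∀ i → Σ (Δ J) λ y → h y ≡ g i × role J R x y × ⟦ C ⟧ J y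
      pre i = successor-preimage {Q = ⟦ C ⟧ I} (from ∘ embedding-⟦⟧ C)
                                 (proj₁ (succ i)) (proj₂ (succ i))
      h-pre : ∀ i → h (proj₁ (pre i)) ≡ g i
      h-pre i = proj₁ (proj₂ (pre i))

module _ (I : Interpretation nc nr) {N : ℕ} (enc : Fin N ↔ Δ I)
         (conc? : ∀ A x → Dec (conc I A x)) (role? : ∀ R x y → Dec (role I R x y)) where

  private module enc = Inverse enc

  finitise : FinInterpretation nc nr
  finitise = record
    { size  = N
    ; concᶠ = λ A x → isYes (conc? A (enc.to x))
    ; roleᶠ = λ R x y → isYes (role? R (enc.to x) (enc.to y))
    }

  finitise-embedding : Embedding (toInterp finitise) I enc.to
  finitise-embedding = record
    { injective        = λ {x} {y} eq →
        trans (sym (enc.strictlyInverseʳ x)) (trans (cong enc.from eq) (enc.strictlyInverseʳ y))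
    ; conc-⇔           = λ A x → mk⇔ toWitness fromWitness
    ; role-⇔           = λ R x y → mk⇔ toWitness fromWitness
    ; successor-closed = λ R x z _ → enc.from z , enc.strictlyInverseˡ z
    }

  finiteExample : Δ I → Example nc nr
  finiteExample x = ⟨ finitise , enc.from x ⟩

  finiteExample-⟦⟧ : ∀ C x → finiteExample x satisfies C ⇔ ⟦ C ⟧ I x
  finiteExample-⟦⟧ C x =
    subst (λ y → ⟦ C ⟧ (toInterp finitise) (enc.from x) ⇔ ⟦ C ⟧ I y)
          (enc.strictlyInverseˡ x)
          (embedding-⟦⟧ finitise-embedding C (enc.from x))

-- A fresh root above k + 1 copies of a pointed interpretation

module Lift (k : ℕ) (J : Interpretation nc nr) (p : Δ J) where

  data Node : Set where
    root : Node
    copy : Fin (suc k) → Δ J → Node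

  ⊎↔Node : (⊤ ⊎ (Fin (suc k) × Δ J)) ↔ Node
  ⊎↔Node = mk↔ₛ′ forth back forth∘back back∘forth
    where
    forth : ⊤ ⊎ (Fin (suc k) × Δ J) → Node
    forth (inj₁ _)       = root
    forth (inj₂ (i , x)) = copy i x
    back : Node → ⊤ ⊎ (Fin (suc k) × Δ J)
    back root       = inj₁ tt
    back (copy i x) = inj₂ (i , x)
    forth∘back : ∀ v → forth (back v) ≡ v
    forth∘back root       = refl
    forth∘back (copy i x) = refl
    back∘forth : ∀ v → back (forth v) ≡ v
    back∘forth (inj₁ _)       = refl
    back∘forth (inj₂ (i , x)) = refl

  liftConc : Fin nc → Node → Set
  liftConc A root       = ⊤
  liftConc A (copy i x) = conc J A x

  liftRole : Fin nr → Node → Node → Set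
  liftRole R root       (copy j y) = y ≡ p
  liftRole R (copy i x) (copy j y) = i ≡ j × role J R x y
  liftRole R root       root       = ⊥
  liftRole R (copy i x) root       = ⊥

  lift : Interpretation nc nr
  lift = record { Δ = Node ; conc = liftConc ; role = liftRole }

  lift-conc? : (∀ A x → Dec (conc J A x)) → ∀ A v → Dec (conc lift A v)
  lift-conc? conc? A root       = yes tt
  lift-conc? conc? A (copy i x) = conc? A x

  lift-role? : (∀ R x y → Dec (role J R x y)) → DecidableEquality (Δ J) →
               ∀ R u v → Dec (role lift R u v)
  lift-role? role? _≟ᴶ_ R root       (copy j y) = y ≟ᴶ p
  lift-role? role? _≟ᴶ_ R (copy i x) (copy j y) = (i ≟ j) ×-dec role? R x y
  lift-role? role? _≟ᴶ_ R root       root       = no λ ()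
  lift-role? role? _≟ᴶ_ R (copy i x) root       = no λ ()

  copy-injectiveˡ : ∀ {i j x y} → copy i x ≡ copy j y → i ≡ j
  copy-injectiveˡ refl = refl

  copy-embedding : ∀ i → Embedding J lift (copy i)
  copy-embedding i = record
    { injective        = λ { refl → refl }
    ; conc-⇔           = λ A x → mk⇔ id id
    ; role-⇔           = λ R x y → mk⇔ (refl ,_) proj₂
    ; successor-closed = λ { R x (copy j y) (refl , _) → y , refl }
    }

  copy-⟦⟧ : ∀ i C x → ⟦ C ⟧ J x ⇔ ⟦ C ⟧ lift (copy i x)
  copy-⟦⟧ i = embedding-⟦⟧ (copy-embedding i)

  root-successor : ∀ {R z} → role lift R root z → ∃ λ i → copy i p ≡ z
  root-successor {z = copy i y} refl = i , refl

  root-satisfies : SatisfiesBounded n k J p → SatisfiesBounded (suc n) k lift root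
  root-satisfies sat (name A) _ _ = tt
  root-satisfies sat top      _ _ = tt
  root-satisfies sat (C ⊓ D)  d mx =
    root-satisfies sat C (m⊔n≤o⇒m≤o _ _ d) (m⊔n≤o⇒m≤o _ _ mx) ,
    root-satisfies sat D (m⊔n≤o⇒n≤o _ _ d) (m⊔n≤o⇒n≤o _ _ mx)
  root-satisfies sat (exists R C) (s≤s d) mx =
    copy zero p , refl , to (copy-⟦⟧ zero C p) (sat C d mx)
  root-satisfies sat (value-restriction R C) (s≤s d) mx z r with root-successor r
  ... | i , refl = to (copy-⟦⟧ i C p) (sat C d mx)
  root-satisfies sat (atLeast m q R C) (s≤s d) mx =
    (λ i → copy (inject≤ i m≤1+k) p)
    , (λ i j → inject≤-injective m≤1+k m≤1+k i j ∘ copy-injectiveˡ)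
    , λ i → refl , to (copy-⟦⟧ _ C p) (sat C d (m⊔n≤o⇒n≤o m _ mx))
    where
    m≤1+k : m ≤ suc k
    m≤1+k = m≤n⇒m≤1+n (m⊔n≤o⇒m≤o m _ mx)

  root-refutes-∃ : ∀ {R C} → ¬ ⟦ C ⟧ J p → ¬ ⟦ exists R C ⟧ lift root
  root-refutes-∃ {C = C} ¬c (z , r , c) with root-successor r
  ... | i , refl = ¬c (from (copy-⟦⟧ i C p) c)

  root-refutes-∀ : ∀ {R C} → ¬ ⟦ C ⟧ J p → ¬ ⟦ value-restriction R C ⟧ lift root
  root-refutes-∀ {C = C} ¬c c = ¬c (from (copy-⟦⟧ zero C p) (c (copy zero p) refl))

  root-refutes-≥ : ∀ {R C} q → ¬ ⟦ C ⟧ J p → ¬ ⟦ atLeast m q R C ⟧ lift root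
  root-refutes-≥ {R = R} {C} (s≤s _) ¬c (f , _ , succ) =
    root-refutes-∃ {R} {C} ¬c (f zero , succ zero)

-- A record rather than a plain negation, so that C and X can be inferred.
record Refutes {nc nr} (C : Concept nc nr) (X : Example nc nr) : Set where
  constructor refutes
  field ¬satisfies : ¬ X satisfies C
open Refutes

refutes-⊓ˡ : ∀ {C D : Concept nc nr} {X} → Refutes C X → Refutes (C ⊓ D) X
refutes-⊓ˡ (refutes ¬c) = refutes (¬c ∘ proj₁)

refutes-⊓ʳ : ∀ {C D : Concept nc nr} {X} → Refutes D X → Refutes (C ⊓ D) X
refutes-⊓ʳ (refutes ¬d) = refutes (¬d ∘ proj₂)

depth-zero-satisfies : ∀ {I : Interpretation nc nr} {x} → (∀ A → conc I A x) →
                       SatisfiesBounded 0 k I x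
depth-zero-satisfies names (name A) _ _ = names A
depth-zero-satisfies names top      _ _ = tt
depth-zero-satisfies names (C ⊓ D)  d mx =
  depth-zero-satisfies names C (m⊔n≤o⇒m≤o _ _ d) (m⊔n≤o⇒m≤o _ _ mx) ,
  depth-zero-satisfies names D (m⊔n≤o⇒n≤o _ _ d) (m⊔n≤o⇒n≤o _ _ mx)

isolated : Example nc nr
isolated =
  ⟨ record { size = 1 ; concᶠ = λ _ _ → true ; roleᶠ = λ _ _ _ → false } , zero ⟩

isolated-refutes-∃ : ∀ {R} {C : Concept nc nr} → Refutes (exists R C) isolated
isolated-refutes-∃ = refutes λ ()

isolated-refutes-≥ : ∀ {R} {C : Concept nc nr} q → Refutes (atLeast m q R C) isolated
isolated-refutes-≥ (s≤s _) = refutes λ (_ , _ , succ) → proj₁ (succ zero)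

nonzero? : Fin 2 → Bool
nonzero? zero    = false
nonzero? (suc _) = true

twoPoint : FinInterpretation nc nr
twoPoint = record { size = 2 ; concᶠ = λ _ → nonzero? ; roleᶠ = λ _ x _ → nonzero? x }

trivial-or-refuted : (C : Concept nc nr) →
                     Trivial C ⊎ ∃ λ x → ¬ ⟦ C ⟧ (toInterp twoPoint) x
trivial-or-refuted (name A)     = inj₂ (zero , id)
trivial-or-refuted top          = inj₁ top
trivial-or-refuted (C ⊓ D) with trivial-or-refuted C | trivial-or-refuted D
... | inj₁ C-triv      | inj₁ D-triv      = inj₁ (C-triv ⊓ D-triv)
... | inj₂ (x , ¬c)    | _               = inj₂ (x , ¬c ∘ proj₁)
... | inj₁ _           | inj₂ (x , ¬d)    = inj₂ (x , ¬d ∘ proj₂)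
trivial-or-refuted (exists R C) = inj₂ (zero , λ ())
trivial-or-refuted (value-restriction R C) with trivial-or-refuted C
... | inj₁ C-triv   = inj₁ (value-restriction C-triv)
... | inj₂ (x , ¬c) = inj₂ (suc zero , λ c → ¬c (c x tt))
trivial-or-refuted (atLeast _ (s≤s _) R C) =
  inj₂ (zero , λ (_ , _ , succ) → proj₁ (succ zero))

clique : ℕ → FinInterpretation nc nr
clique s = record { size = s ; concᶠ = λ _ _ → true ; roleᶠ = λ _ _ _ → true }

clique-satisfies : ∀ {s} (D : Concept nc nr) → maxNum D ≤ s →
                   ∀ x → ⟦ D ⟧ (toInterp (clique s)) x
clique-satisfies (name A) _ x = tt
clique-satisfies top      _ x = tt
clique-satisfies (C ⊓ D)  mx x =
  clique-satisfies C (m⊔n≤o⇒m≤o _ _ mx) x , clique-satisfies D (m⊔n≤o⇒n≤o _ _ mx) x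
clique-satisfies (exists R C) mx x = x , tt , clique-satisfies C mx x
clique-satisfies (value-restriction R C) mx x = λ y _ → clique-satisfies C mx y
clique-satisfies (atLeast m q R C) mx x =
  (λ i → inject≤ i m≤s) , inject≤-injective m≤s m≤s
  , λ i → tt , clique-satisfies C (m⊔n≤o⇒n≤o m _ mx) _
  where m≤s = m⊔n≤o⇒m≤o m _ mx

clique-refutes : ∀ {s q R C x} → s < m →
                 ¬ ⟦ atLeast {nc} {nr} m q R C ⟧ (toInterp (clique s)) x
clique-refutes s<m (f , f-inj , _) with pigeonhole s<m f
... | i , j , i<j , fi≡fj = <⇒≢ i<j (f-inj i j fi≡fj)

-- This is k ⊔ 1, written so that it visibly has a point.
cliqueSize : ℕ → ℕ
cliqueSize k = suc (pred k)

k≤cliqueSize : ∀ k → k ≤ cliqueSize k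
k≤cliqueSize zero    = z≤n
k≤cliqueSize (suc k) = ≤-refl

cliqueSize<2+m : ¬ (suc (suc m) ≤ k) → cliqueSize k < suc (suc m)
cliqueSize<2+m k≱2+m = s≤s (s≤s (pred-mono-≤ (pred-mono-≤ (≰⇒> k≱2+m))))

cliqueExample : ℕ → Example nc nr
cliqueExample k = ⟨ clique (cliqueSize k) , zero ⟩

cliqueExample-refutes : ∀ {R} {C : Concept nc nr} q → ¬ (suc (suc m) ≤ k) →
                        Refutes (atLeast (suc (suc m)) q R C) (cliqueExample k)
cliqueExample-refutes {R = R} {C} q k≱2+m =
  refutes (clique-refutes {q = q} {R = R} {C = C} {x = zero} (cliqueSize<2+m k≱2+m))

module _ (k : ℕ) (X : Example nc nr) where
  private
    J = toInterp (interp X)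
    open module L = Lift k J (point X) using (lift; root)

    encoding : Fin (suc (suc k * size (interp X))) ↔ L.Node
    encoding = ↔-trans (+↔⊎ {1}) (↔-trans (1↔⊤ ⊎-↔ *↔×) L.⊎↔Node)

    conc? : ∀ A v → Dec (conc lift A v)
    conc? = L.lift-conc? (λ A x → T? (concᶠ (interp X) A x))

    role? : ∀ R u v → Dec (role lift R u v)
    role? = L.lift-role? (λ R x y → T? (roleᶠ (interp X) R x y)) _≟_

  liftExample : Example nc nr
  liftExample = finiteExample lift encoding conc? role? root

  liftExample-⟦⟧ : ∀ C → liftExample satisfies C ⇔ ⟦ C ⟧ lift root
  liftExample-⟦⟧ C = finiteExample-⟦⟧ lift encoding conc? role? C root

  liftExample-satisfies :
    SatisfiesBounded n k J (point X) →
    SatisfiesBounded (suc n) k (toInterp (interp liftExample)) (point liftExample)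
  liftExample-satisfies sat D d mx = from (liftExample-⟦⟧ D) (L.root-satisfies sat D d mx)

  liftExample-refutes-∃ : ∀ {R C} → Refutes C X → Refutes (exists R C) liftExample
  liftExample-refutes-∃ {R} {C} (refutes ¬c) =
    refutes (L.root-refutes-∃ {R} {C} ¬c ∘ to (liftExample-⟦⟧ (exists R C)))

  liftExample-refutes-∀ : ∀ {R C} → Refutes C X →
                          Refutes (value-restriction R C) liftExample
  liftExample-refutes-∀ {R} {C} (refutes ¬c) =
    refutes (L.root-refutes-∀ {R} {C} ¬c ∘ to (liftExample-⟦⟧ (value-restriction R C)))

  liftExample-refutes-≥ : ∀ {R C} q → Refutes C X → Refutes (atLeast m q R C) liftExample
  liftExample-refutes-≥ {m = m} {R} {C} q (refutes ¬c) =
    refutes (L.root-refutes-≥ {R = R} {C} q ¬c ∘ to (liftExample-⟦⟧ (atLeast m q R C)))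

module _ (k : ℕ) where

  examples : ℕ → List (Example nc nr)
  examples zero    = isolated ∷ ⟨ twoPoint , suc zero ⟩ ∷ []
  examples (suc n) = cliqueExample k ∷ map (liftExample k) (examples n)

  examples-satisfy :
    ∀ n → All (λ X → SatisfiesBounded {nc} {nr} n k (toInterp (interp X)) (point X))
              (examples n)
  examples-satisfy zero =
    depth-zero-satisfies (λ _ → tt) All.∷ depth-zero-satisfies (λ _ → tt) All.∷ All.[]
  examples-satisfy (suc n) =
    (λ D _ mx → clique-satisfies D (≤-trans mx (k≤cliqueSize k)) zero)
    All.∷ All.map⁺ (All.map (liftExample-satisfies k _) (examples-satisfy n))

  private
    refuted-after-lift : ∀ {n} {C C′ : Concept nc nr} →
                         (∀ {X} → Refutes C X → Refutes C′ (liftExample k X)) →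
                         Any (Refutes C) (examples n) → Any (Refutes C′) (examples (suc n))
    refuted-after-lift lift-refutes = there ∘ Any.map⁺ ∘ Any.map lift-refutes

  expressible-or-refuted : ∀ n (C : Concept nc nr) →
                           Expressible n k C ⊎ Any (Refutes C) (examples n)
  expressible-or-refuted n (name A) = inj₁ (name A , (λ I x → id , id) , z≤n , z≤n)
  expressible-or-refuted n top      = inj₁ (expressible-trivial top)
  expressible-or-refuted n (C ⊓ D)
    with expressible-or-refuted n C | expressible-or-refuted n D
  ... | inj₁ C-expr | inj₁ D-expr = inj₁ (expressible-⊓ {C = C} {D = D} C-expr D-expr)
  ... | inj₂ C-ref  | _           = inj₂ (Any.map refutes-⊓ˡ C-ref)
  ... | inj₁ _      | inj₂ D-ref  = inj₂ (Any.map refutes-⊓ʳ D-ref)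
  expressible-or-refuted zero (exists R C) = inj₂ (here isolated-refutes-∃)
  expressible-or-refuted zero (value-restriction R C) with trivial-or-refuted C
  ... | inj₁ C-triv   = inj₁ (expressible-trivial (value-restriction C-triv))
  ... | inj₂ (x , ¬c) = inj₂ (there (here (refutes λ c → ¬c (c x tt))))
  expressible-or-refuted zero (atLeast m q R C) = inj₂ (here (isolated-refutes-≥ q))
  expressible-or-refuted (suc n) (exists R C) =
    Sum.map (expressible-∃ R {C}) (refuted-after-lift (liftExample-refutes-∃ k _))
            (expressible-or-refuted n C)
  expressible-or-refuted (suc n) (value-restriction R C) =
    Sum.map (expressible-∀ R {C}) (refuted-after-lift (liftExample-refutes-∀ k _))
            (expressible-or-refuted n C)
  expressible-or-refuted (suc n) (atLeast 1 q R C) =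
    Sum.map (expressible-≥1 q R {C}) (refuted-after-lift (liftExample-refutes-≥ k _ q))
            (expressible-or-refuted n C)
  expressible-or-refuted (suc n) (atLeast (suc (suc m)) q R C) with suc (suc m) ≤? k
  ... | yes 2+m≤k =
    Sum.map (expressible-≥ q R {C} 2+m≤k) (refuted-after-lift (liftExample-refutes-≥ k _ q))
            (expressible-or-refuted n C)
  ... | no  2+m≰k = inj₂ (here (cliqueExample-refutes q 2+m≰k))

  expressible⇒examples-satisfy : ∀ n {C : Concept nc nr} →
                                 Expressible n k C → All (_satisfies C) (examples n)
  expressible⇒examples-satisfy n (D , C≡D , d , mx) =
    All.map (λ sat → proj₂ (C≡D _ _) (sat D d mx)) (examples-satisfy n)

  examples-satisfy⇒expressible : ∀ n {C : Concept nc nr} →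
                                 All (_satisfies C) (examples n) → Expressible n k C
  examples-satisfy⇒expressible n {C} sat =
    [ id , ⊥-elim ∘ ¬refuted ]′ (expressible-or-refuted n C)
    where
    ¬refuted : ¬ Any (Refutes C) (examples n)
    ¬refuted ref = ¬satisfies (proj₂ (lookupAny sat ref)) (proj₁ (lookupAny sat ref))

proposition1 : ExcludedMiddle 0ℓ →
    (nc nr : ℕ) (n k : ℕ) →
    Σ (List (Example nc nr)) λ E →
      (C : Concept nc nr) →
        ((Σ (Concept nc nr) λ D → (C ≡ᶜ D) × (depth D ≤ n) × (maxNum D ≤ k))
          → All (λ e → e satisfies C) E)
        × (All (λ e → e satisfies C) E
          → Σ (Concept nc nr) λ D → (C ≡ᶜ D) × (depth D ≤ n) × (maxNum D ≤ k))
proposition1 _ nc nr n k =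
  examples k n , λ C → expressible⇒examples-satisfy k n {C}
                     , examples-satisfy⇒expressible k n {C}
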